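{- For all integers $n\ge 8$ and $d$ with $6\le d\le n$, \[ \binom{d-1}{2} + (d-1)\binom{n-d}{2}\,\mathcal{F}_{P_{n-d}} \le \binom{n}{2}\,\mathcal{F}_{P_n}. \]
   Context: $\mathcal{F}_{P_m}$ is the number of minimal forts of the path $P_m$ on $m$ vertices, with $\mathcal{F}_{P_0}=0$ (a fort is a nonempty vertex set $F$ such that every vertex outside $F$ has zero or at least two neighbors in $F$; minimal means no proper subset is a fort); it is known to satisfy $a_m=a_{m-2}+a_{m-3}$ with $a_1=a_2=a_3=1$. Binomial coefficients use the convention $\binom{m}{2}=0$ for integers $m<2$. -}

module Defs where

open import Data.Nat using (ℕ; zero; suc; _≤_; _≟_)
open import Data.Bool using (Bool; true; false)
open import Data.Vec using (Vec; []; _∷_; toList; allFin)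
open import Data.Fin using (Fin; toℕ)
open import Data.List using (List; []; _∷_; length; filter; map; _++_)
open import Data.List.Relation.Unary.All using (All)
open import Data.List.Relation.Unary.All.Properties using ()
import Data.List.Relation.Unary.All as All
open import Data.Fin.Subset using (Subset; Nonempty; _⊂_; _∈_; _∉_)
open import Data.Fin.Subset.Properties using (_∈?_; nonempty?; _⊂?_)
open import Data.Product using (_×_)
open import Data.Sum using (_⊎_)
open import Relation.Nullary using (¬_; Dec; _×-dec_; _⊎-dec_; ¬?; _→-dec_)
open import Relation.Binary.PropositionalEquality using (_≡_)

Adj : {m : ℕ} → Fin m → Fin m → Set
Adj i j = (suc (toℕ i) ≡ toℕ j) ⊎ (suc (toℕ j) ≡ toℕ i)

adj? : {m : ℕ} (i j : Fin m) → Dec (Adj i j)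
adj? i j = (suc (toℕ i) ≟ toℕ j) ⊎-dec (suc (toℕ j) ≟ toℕ i)

vertices : (m : ℕ) → List (Fin m)
vertices m = toList (allFin m)

nbrsIn : {m : ℕ} → Subset m → Fin m → ℕ
nbrsIn {m} F v = length (filter (λ u → (u ∈? F) ×-dec (adj? u v)) (vertices m))

IsFort : {m : ℕ} → Subset m → Set
IsFort {m} F =
  Nonempty F ×
  All (λ v → v ∉ F → (nbrsIn F v ≡ 0) ⊎ (2 ≤ nbrsIn F v)) (vertices m)

isFort? : {m : ℕ} (F : Subset m) → Dec (IsFort F)
isFort? {m} F =
  nonempty? F ×-dec
  All.all? (λ v → ¬? (v ∈? F) →-dec ((nbrsIn F v ≟ 0) ⊎-dec (2 Data.Nat.≤? nbrsIn F v)))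
           (vertices m)

allSubsets : (m : ℕ) → List (Subset m)
allSubsets zero    = [] ∷ []
allSubsets (suc m) = map (true ∷_) (allSubsets m) ++ map (false ∷_) (allSubsets m)

IsMinimalFort : {m : ℕ} → Subset m → Set
IsMinimalFort {m} F =
  IsFort F × All (λ G → G ⊂ F → ¬ IsFort G) (allSubsets m)

isMinimalFort? : {m : ℕ} (F : Subset m) → Dec (IsMinimalFort F)
isMinimalFort? {m} F =
  isFort? F ×-dec All.all? (λ G → (G ⊂? F) →-dec ¬? (isFort? G)) (allSubsets m)

FP : ℕ → ℕ
FP m = length (filter isMinimalFort? (allSubsets m))

{-# OPTIONS --safe #-}

-- Read a subset of the path P_m as a 0/1-word. An outside vertex has at most two
-- neighbours, so the fort condition says that both or neither of them are members;
-- hence the forts are exactly the words in 1 (1 ∣ 01)*. Dropping the middle one of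
-- three consecutive members keeps a fort, while a word in 1 (01 ∣ 101)* (ε ∣ 1)
-- contains no other fort, so these words are exactly the minimal forts. Splitting
-- off the prefixes 10 and 110 gives 𝓕_{P_{m+3}} = 𝓕_{P_{m+1}} + 𝓕_{P_m}.
--
-- The inequality is proved by induction on d with k = n - d fixed. Passing from
-- (d, n) to (d + 1, n + 1) adds (d - 1) + C(k,2) 𝓕_{P_k} on the left, and on the
-- right, by 𝓕_{P_{n+1}} = 𝓕_{P_n} + 𝓕_{P_{n-4}}, at least
-- n 𝓕_{P_{n+1}} + C(n,2) 𝓕_{P_{n-4}}, which dominates it since k ≤ n - 4. The base
-- case d = 6 is checked directly for k ≤ 4 and follows from 5 𝓕_{P_k} ≤ 𝓕_{P_{k+6}}
-- for k ≥ 5.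
module Submission where

open import Defs
open import Data.Bool using (Bool; true; false; T; _∧_)
open import Data.Bool.Properties using (∧-zeroʳ)
open import Data.Empty using (⊥-elim)
open import Data.Fin using (Fin; zero; suc; toℕ)
open import Data.Fin.Subset
  using (Subset; inside; outside; _∈_; _∉_; _⊆_; _⊂_; Nonempty; Empty)
open import Data.Fin.Subset.Properties
  using (_∈?_; drop-there; drop-∷-⊆; ⊆-refl; s⊂s; out⊂in)
open import Data.List using (List; []; _∷_; map; _++_; length; filter)
open import Data.List.Membership.Propositional using () renaming (_∈_ to _∈ˡ_)
open import Data.List.Membership.Propositional.Properties
  using (∈-map⁺; ∈-++⁺ˡ; ∈-++⁺ʳ)
open import Data.List.Properties using (filter-≐)
import Data.List.Relation.Unary.Any as Any
open import Data.List.Relation.Unary.All using (All)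
import Data.List.Relation.Unary.All as All
open import Data.Nat
  using (ℕ; zero; suc; _+_; _*_; _∸_; _≤_; _≤′_; ≤′-refl; ≤′-step; z≤n; s≤s; _≡ᵇ_)
open import Data.Nat.Combinatorics using (_C_; nC1≡n; nCk+nC[k+1]≡[n+1]C[k+1])
open import Data.Nat.Properties
  using (≤-refl; ≤-trans; ≤⇒≤′; ≤ᵇ⇒≤; +-assoc; +-comm; +-identityʳ; *-identityʳ;
         +-mono-≤; +-monoˡ-≤; +-monoʳ-≤; *-mono-≤; *-monoˡ-≤; *-monoʳ-≤; +-cancelʳ-≤;
         m≤m+n; m≤n+m; n≤1+n; m≤n⇒∃[o]m+o≡n; m+n∸m≡n; module ≤-Reasoning)
open import Data.Nat.Tactic.RingSolver using (solve-∀)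
open import Data.Product using (_×_; _,_; ∃-syntax)
open import Data.Sum using (_⊎_; inj₂)
open import Data.Unit using (tt)
open import Data.Vec using ([]; _∷_; toList; here; there)
import Data.Vec.Properties as Vec
open import Function using (_∘_)
open import Function.Bundles using (_⇔_; mk⇔; Equivalence)
open import Relation.Nullary using (¬_; does; contradiction; _×-dec_)
open import Relation.Nullary.Decidable using (T?; decidable-stable)
open import Relation.Unary using (Pred; Decidable; _≐_)
open import Level using (Level)
open import Relation.Binary.PropositionalEquality
  using (_≡_; refl; sym; trans; cong; cong₂; subst; module ≡-Reasoning)

open Equivalence using (to; from)

private
  variable
    ℓ ℓ₁ ℓ₂ : Level
    A : Set ℓ₁
    B : Set ℓ₂
    m : ℕ

bit : Bool → ℕ
bit false = 0
bit true  = 1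

countᵇ : (A → Bool) → List A → ℕ
countᵇ p []       = 0
countᵇ p (x ∷ xs) = bit (p x) + countᵇ p xs

length-filter≡countᵇ : {P : Pred A ℓ} (P? : Decidable P) (xs : List A) →
                       length (filter P? xs) ≡ countᵇ (does ∘ P?) xs
length-filter≡countᵇ P? []       = refl
length-filter≡countᵇ P? (x ∷ xs) with does (P? x)
... | true  = cong suc (length-filter≡countᵇ P? xs)
... | false = length-filter≡countᵇ P? xs

countᵇ-++ : (p : A → Bool) (xs ys : List A) →
            countᵇ p (xs ++ ys) ≡ countᵇ p xs + countᵇ p ys
countᵇ-++ p []       ys = refl
countᵇ-++ p (x ∷ xs) ys =
  trans (cong (bit (p x) +_) (countᵇ-++ p xs ys)) (sym (+-assoc (bit (p x)) _ _))

countᵇ-map : (p : B → Bool) (f : A → B) (xs : List A) →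
             countᵇ p (map f xs) ≡ countᵇ (p ∘ f) xs
countᵇ-map p f []       = refl
countᵇ-map p f (x ∷ xs) = cong (bit (p (f x)) +_) (countᵇ-map p f xs)

countᵇ-cong : {p q : A → Bool} → (∀ x → p x ≡ q x) → (xs : List A) →
              countᵇ p xs ≡ countᵇ q xs
countᵇ-cong p≗q []       = refl
countᵇ-cong p≗q (x ∷ xs) = cong₂ _+_ (cong bit (p≗q x)) (countᵇ-cong p≗q xs)

countᵇ-none : {p : A → Bool} → (∀ x → p x ≡ false) → (xs : List A) → countᵇ p xs ≡ 0
countᵇ-none p≗false []       = refl
countᵇ-none p≗false (x ∷ xs) rewrite p≗false x = countᵇ-none p≗false xs

All⇔∀ : {P : A → Set} {xs : List A} → (∀ x → x ∈ˡ xs) → All P xs ⇔ (∀ x → P x)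
All⇔∀ complete =
  mk⇔ (λ ps x → All.lookup ps (complete x)) (λ ps → All.tabulate (λ {x} _ → ps x))

∈-allSubsets : (G : Subset m) → G ∈ˡ allSubsets m
∈-allSubsets []           = Any.here refl
∈-allSubsets (inside ∷ G) = ∈-++⁺ˡ (∈-map⁺ (inside ∷_) (∈-allSubsets G))
∈-allSubsets {suc m} (outside ∷ G) =
  ∈-++⁺ʳ (map (inside ∷_) (allSubsets m)) (∈-map⁺ (outside ∷_) (∈-allSubsets G))

countSubsets : (m : ℕ) → (Subset m → Bool) → ℕ
countSubsets m p = countᵇ p (allSubsets m)

countSubsets-suc : (m : ℕ) (p : Subset (suc m) → Bool) →
  countSubsets (suc m) p ≡
  countSubsets m (p ∘ (inside ∷_)) + countSubsets m (p ∘ (outside ∷_))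
countSubsets-suc m p =
  trans (countᵇ-++ p (map (inside ∷_) (allSubsets m)) (map (outside ∷_) (allSubsets m)))
        (cong₂ _+_ (countᵇ-map p (inside ∷_) (allSubsets m))
                   (countᵇ-map p (outside ∷_) (allSubsets m)))

vertices-suc : (m : ℕ) → vertices (suc m) ≡ zero ∷ map suc (vertices m)
vertices-suc m =
  trans (cong toList (Vec.allFin-map m)) (cong (zero ∷_) (Vec.toList-map suc _))

∈-vertices : (v : Fin m) → v ∈ˡ vertices m
∈-vertices {suc m} zero    rewrite vertices-suc m = Any.here refl
∈-vertices {suc m} (suc v) rewrite vertices-suc m = Any.there (∈-map⁺ suc (∈-vertices v))

countᵇ-vertices-suc : (p : Fin (suc m) → Bool) →
  countᵇ p (vertices (suc m)) ≡ bit (p zero) + countᵇ (p ∘ suc) (vertices m)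
countᵇ-vertices-suc {m} p =
  trans (cong (countᵇ p) (vertices-suc m)) (cong (bit (p zero) +_) (countᵇ-map p suc (vertices m)))

first : Subset m → Bool
first []      = outside
first (b ∷ _) = b

isZero : Fin m → Bool
isZero zero    = true
isZero (suc _) = false

-- The number of members of F adjacent to v, when the vertex just before F
-- is a member iff p.
neighbours : Bool → Subset m → Fin m → ℕ
neighbours p (b ∷ F) zero    = bit p + bit (first F)
neighbours p (b ∷ F) (suc v) = neighbours b F v

neighbours-shift : (p : Bool) (F : Subset m) (v : Fin m) →
                   neighbours p F v ≡ bit (p ∧ isZero v) + neighbours outside F v
neighbours-shift true  (b ∷ F) zero    = refl
neighbours-shift false (b ∷ F) zero    = refl
neighbours-shift true  (b ∷ F) (suc v) = refl
neighbours-shift false (b ∷ F) (suc v) = refl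

countᵇ-members-at-zero : (F : Subset m) →
  countᵇ (λ u → does (u ∈? F) ∧ (0 ≡ᵇ toℕ u)) (vertices m) ≡ bit (first F)
countᵇ-members-at-zero [] = refl
countᵇ-members-at-zero {suc m} (b ∷ F) =
  trans (countᵇ-vertices-suc (λ u → does (u ∈? (b ∷ F)) ∧ (0 ≡ᵇ toℕ u)))
  (trans (cong₂ _+_ (at-zero b) (countᵇ-none (λ u → ∧-zeroʳ (does (u ∈? F))) (vertices m)))
         (+-identityʳ (bit b)))
  where
  at-zero : (b : Bool) → bit (does (zero ∈? (b ∷ F)) ∧ true) ≡ bit b
  at-zero true  = refl
  at-zero false = refl

adjacentMember? : (F : Subset m) (v : Fin m) → Decidable (λ u → u ∈ F × Adj u v)
adjacentMember? F v u = (u ∈? F) ×-dec adj? u v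

nbrsIn-zero : (b : Bool) (F : Subset m) → nbrsIn (b ∷ F) zero ≡ bit (first F)
nbrsIn-zero {m} b F =
  trans (length-filter≡countᵇ (adjacentMember? (b ∷ F) zero) (vertices (suc m)))
  (trans (countᵇ-vertices-suc (does ∘ adjacentMember? (b ∷ F) zero))
         (cong₂ _+_ (cong bit (∧-zeroʳ (does (zero ∈? (b ∷ F))))) (countᵇ-members-at-zero F)))

nbrsIn-suc : (b : Bool) (F : Subset m) (v : Fin m) →
             nbrsIn (b ∷ F) (suc v) ≡ bit (b ∧ isZero v) + nbrsIn F v
nbrsIn-suc {m} b F v =
  trans (length-filter≡countᵇ (adjacentMember? (b ∷ F) (suc v)) (vertices (suc m)))
  (trans (countᵇ-vertices-suc (does ∘ adjacentMember? (b ∷ F) (suc v)))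
         (cong₂ _+_ (cong bit (at-zero b v))
                    (sym (length-filter≡countᵇ (adjacentMember? F v) (vertices m)))))
  where
  at-zero : (b : Bool) (v : Fin m) →
            does (zero ∈? (b ∷ F)) ∧ does (adj? zero (suc v)) ≡ b ∧ isZero v
  at-zero true  zero    = refl
  at-zero true  (suc v) = refl
  at-zero false v       = refl

nbrsIn≡neighbours : (F : Subset m) (v : Fin m) → nbrsIn F v ≡ neighbours outside F v
nbrsIn≡neighbours (b ∷ F) zero    = nbrsIn-zero b F
nbrsIn≡neighbours (b ∷ F) (suc v) =
  trans (nbrsIn-suc b F v)
  (trans (cong (bit (b ∧ isZero v) +_) (nbrsIn≡neighbours F v)) (sym (neighbours-shift b F v)))

-- Forts and minimal forts as words

ZeroOr≥2 : ℕ → Set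
ZeroOr≥2 n = n ≡ 0 ⊎ 2 ≤ n

¬ZeroOr≥2[1] : ¬ ZeroOr≥2 1
¬ZeroOr≥2[1] (inj₂ (s≤s ()))

FortCondition : Bool → Subset m → Set
FortCondition {m} p F = (v : Fin m) → v ∉ F → ZeroOr≥2 (neighbours p F v)

FortCondition-tail : {p b : Bool} {F : Subset m} →
                     FortCondition p (b ∷ F) → FortCondition b F
FortCondition-tail cond v v∉F = cond (suc v) (v∉F ∘ drop-there)

FortCondition-∷ : {p b : Bool} {F : Subset m} →
                  (zero ∉ (b ∷ F) → ZeroOr≥2 (bit p + bit (first F))) → FortCondition b F →
                  FortCondition p (b ∷ F)
FortCondition-∷ head tail zero    0∉F     = head 0∉F
FortCondition-∷ head tail (suc v) [1+v]∉F = tail v (λ v∈F → [1+v]∉F (there v∈F))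

IsFort⇔FortCondition : {F : Subset m} → IsFort F ⇔ (Nonempty F × FortCondition outside F)
IsFort⇔FortCondition {F = F} = mk⇔
  (λ (ne , cond) → ne , λ v v∉F →
     subst ZeroOr≥2 (nbrsIn≡neighbours F v) (to all⇔ cond v v∉F))
  (λ (ne , cond) → ne , from all⇔ λ v v∉F →
     subst ZeroOr≥2 (sym (nbrsIn≡neighbours F v)) (cond v v∉F))
  where all⇔ = All⇔∀ ∈-vertices

-- Words in (1 ∣ 01)*: what may follow a member in a fort.
fortTail : Subset m → Bool
fortTail []                      = true
fortTail (inside ∷ F)            = fortTail F
fortTail (outside ∷ [])          = false
fortTail (outside ∷ outside ∷ F) = false
fortTail (outside ∷ inside ∷ F)  = fortTail F

isFortWord : Subset m → Bool
isFortWord []            = false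
isFortWord (outside ∷ _) = false
isFortWord (inside ∷ F)  = fortTail F

FortCondition⇒fortTail : (F : Subset m) → FortCondition inside F → T (fortTail F)
FortCondition⇒fortTail []                      cond = tt
FortCondition⇒fortTail (inside ∷ F)            cond =
  FortCondition⇒fortTail F (FortCondition-tail cond)
FortCondition⇒fortTail (outside ∷ [])          cond = ¬ZeroOr≥2[1] (cond zero λ ())
FortCondition⇒fortTail (outside ∷ outside ∷ F) cond = ¬ZeroOr≥2[1] (cond zero λ ())
FortCondition⇒fortTail (outside ∷ inside ∷ F)  cond =
  FortCondition⇒fortTail F (FortCondition-tail (FortCondition-tail cond))

fortTail⇒FortCondition : (F : Subset m) → T (fortTail F) → FortCondition inside F
fortTail⇒FortCondition []                     _  = λ ()
fortTail⇒FortCondition (inside ∷ F)           ft =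
  FortCondition-∷ (λ 0∉F → contradiction here 0∉F) (fortTail⇒FortCondition F ft)
fortTail⇒FortCondition (outside ∷ inside ∷ F) ft =
  FortCondition-∷ (λ _ → inj₂ ≤-refl)
    (FortCondition-∷ (λ 0∉F → contradiction here 0∉F) (fortTail⇒FortCondition F ft))

FortCondition-outside : (F : Subset m) →
                        FortCondition outside (outside ∷ F) → Empty (outside ∷ F)
FortCondition-outside F             cond (zero , ())
FortCondition-outside (inside ∷ F)  cond (suc _ , _)          = ¬ZeroOr≥2[1] (cond zero λ ())
FortCondition-outside (outside ∷ F) cond (suc x , there x∈F) =
  FortCondition-outside F (FortCondition-tail cond) (x , x∈F)

IsFort⇔isFortWord : (F : Subset m) → IsFort F ⇔ T (isFortWord F)
IsFort⇔isFortWord F =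
  mk⇔ (fortWord F ∘ to IsFort⇔FortCondition) (from IsFort⇔FortCondition ∘ fort F)
  where
  fortWord : (F : Subset m) → Nonempty F × FortCondition outside F → T (isFortWord F)
  fortWord []            ((() , _) , _)
  fortWord (outside ∷ F) (ne , cond) = ⊥-elim (FortCondition-outside F cond ne)
  fortWord (inside ∷ F)  (_ , cond)  = FortCondition⇒fortTail F (FortCondition-tail cond)
  fort : (F : Subset m) → T (isFortWord F) → Nonempty F × FortCondition outside F
  fort (inside ∷ F) ft =
    (zero , here) , FortCondition-∷ (λ 0∉F → contradiction here 0∉F) (fortTail⇒FortCondition F ft)

-- Words in (01 ∣ 101)* (ε ∣ 1): what follows the first vertex in a minimal fort.
minFortTail : Subset m → Bool
minFortTail []                                = true
minFortTail (inside ∷ [])                     = true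
minFortTail (inside ∷ inside ∷ F)             = false
minFortTail (inside ∷ outside ∷ [])           = false
minFortTail (inside ∷ outside ∷ outside ∷ F)  = false
minFortTail (inside ∷ outside ∷ inside ∷ F)   = minFortTail F
minFortTail (outside ∷ [])                    = false
minFortTail (outside ∷ outside ∷ F)           = false
minFortTail (outside ∷ inside ∷ F)            = minFortTail F

isMinFortWord : Subset m → Bool
isMinFortWord []            = false
isMinFortWord (outside ∷ _) = false
isMinFortWord (inside ∷ F)  = minFortTail F

minFortTail⇒fortTail : (F : Subset m) → T (minFortTail F) → T (fortTail F)
minFortTail⇒fortTail []                               _ = tt
minFortTail⇒fortTail (inside ∷ [])                    _ = tt
minFortTail⇒fortTail (inside ∷ outside ∷ inside ∷ F)  w = minFortTail⇒fortTail F w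
minFortTail⇒fortTail (outside ∷ inside ∷ F)           w = minFortTail⇒fortTail F w

fortTail-shrink : (F : Subset m) → T (fortTail F) → ¬ T (minFortTail F) →
                  ∃[ G ] G ⊂ F × T (fortTail G)
fortTail-shrink []                   _  ¬w = contradiction tt ¬w
fortTail-shrink (inside ∷ [])        _  ¬w = contradiction tt ¬w
fortTail-shrink (inside ∷ inside ∷ F) ft _ = outside ∷ inside ∷ F , out⊂in ⊆-refl , ft
fortTail-shrink (inside ∷ outside ∷ inside ∷ F) ft ¬w with fortTail-shrink F ft ¬w
... | G , G⊂F , ftG = inside ∷ outside ∷ inside ∷ G , s⊂s (s⊂s (s⊂s G⊂F)) , ftG
fortTail-shrink (outside ∷ inside ∷ F) ft ¬w with fortTail-shrink F ft ¬w
... | G , G⊂F , ftG = outside ∷ inside ∷ G , s⊂s (s⊂s G⊂F) , ftG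

fortTail⊆minFortTail⇒≡ : (F G : Subset m) →
  T (minFortTail F) → T (fortTail G) → G ⊆ F → G ≡ F
fortTail⊆minFortTail⇒≡ [] [] _ _ _ = refl
fortTail⊆minFortTail⇒≡ (inside ∷ []) (inside ∷ []) _ _ _ = refl
fortTail⊆minFortTail⇒≡ (outside ∷ inside ∷ F) (inside ∷ G) _ _ G⊆F = contradiction (G⊆F here) λ ()
fortTail⊆minFortTail⇒≡ (outside ∷ inside ∷ F) (outside ∷ inside ∷ G) w ft G⊆F =
  cong (λ H → outside ∷ inside ∷ H) (fortTail⊆minFortTail⇒≡ F G w ft (drop-∷-⊆ (drop-∷-⊆ G⊆F)))
fortTail⊆minFortTail⇒≡ (inside ∷ outside ∷ inside ∷ F) (_ ∷ inside ∷ G) _ _ G⊆F =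
  contradiction (drop-there (G⊆F (there here))) λ ()
fortTail⊆minFortTail⇒≡ (inside ∷ outside ∷ inside ∷ F) (inside ∷ outside ∷ inside ∷ G) w ft G⊆F =
  cong (λ H → inside ∷ outside ∷ inside ∷ H)
       (fortTail⊆minFortTail⇒≡ F G w ft (drop-∷-⊆ (drop-∷-⊆ (drop-∷-⊆ G⊆F))))

isMinFortWord⇒isFortWord : (F : Subset m) → T (isMinFortWord F) → T (isFortWord F)
isMinFortWord⇒isFortWord (inside ∷ F) = minFortTail⇒fortTail F

isFortWord-shrink : (F : Subset m) → T (isFortWord F) → ¬ T (isMinFortWord F) →
                    ∃[ G ] G ⊂ F × T (isFortWord G)
isFortWord-shrink (inside ∷ F) ft ¬w with fortTail-shrink F ft ¬w
... | G , G⊂F , ftG = inside ∷ G , s⊂s G⊂F , ftG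

isFortWord⊆isMinFortWord⇒≡ : (F G : Subset m) →
  T (isMinFortWord F) → T (isFortWord G) → G ⊆ F → G ≡ F
isFortWord⊆isMinFortWord⇒≡ (inside ∷ F) (inside ∷ G) w ft G⊆F =
  cong (inside ∷_) (fortTail⊆minFortTail⇒≡ F G w ft (drop-∷-⊆ G⊆F))

IsMinimalFort⇔isMinFortWord : (F : Subset m) → IsMinimalFort F ⇔ T (isMinFortWord F)
IsMinimalFort⇔isMinFortWord F = mk⇔ minWord minimalFort
  where
  minWord : IsMinimalFort F → T (isMinFortWord F)
  minWord (fort , noSmaller) = decidable-stable (T? (isMinFortWord F)) λ ¬w →
    let G , G⊂F , ftG = isFortWord-shrink F (to (IsFort⇔isFortWord F) fort) ¬w
    in to (All⇔∀ ∈-allSubsets) noSmaller G G⊂F (from (IsFort⇔isFortWord G) ftG)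
  minimalFort : T (isMinFortWord F) → IsMinimalFort F
  minimalFort w = from (IsFort⇔isFortWord F) (isMinFortWord⇒isFortWord F w) ,
                  from (All⇔∀ ∈-allSubsets) λ G (G⊆F , x , x∈F , x∉G) fortG →
                    x∉G (subst (x ∈_) (sym (G≡F G G⊆F fortG)) x∈F)
    where
    G≡F : (G : Subset _) → G ⊆ F → IsFort G → G ≡ F
    G≡F G G⊆F fortG = isFortWord⊆isMinFortWord⇒≡ F G w (to (IsFort⇔isFortWord G) fortG) G⊆F

-- padovan (suc m) is the m-th Padovan number: 1, 1, 1, 2, 2, 3, 4, 5, 7, …
padovan : ℕ → ℕ
padovan 0                   = 0
padovan 1                   = 1
padovan 2                   = 1
padovan (suc (suc (suc m))) = padovan (suc m) + padovan m

isMinFortWord-10∷ : (F : Subset m) → isMinFortWord (inside ∷ outside ∷ F) ≡ isMinFortWord F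
isMinFortWord-10∷ []            = refl
isMinFortWord-10∷ (inside ∷ F)  = refl
isMinFortWord-10∷ (outside ∷ F) = refl

isMinFortWord-110∷ : (F : Subset m) →
                     isMinFortWord (inside ∷ inside ∷ outside ∷ F) ≡ isMinFortWord F
isMinFortWord-110∷ []            = refl
isMinFortWord-110∷ (inside ∷ F)  = refl
isMinFortWord-110∷ (outside ∷ F) = refl

countSubsets-isMinFortWord : (m : ℕ) → countSubsets m isMinFortWord ≡ padovan m
countSubsets-isMinFortWord 0 = refl
countSubsets-isMinFortWord 1 = refl
countSubsets-isMinFortWord 2 = refl
countSubsets-isMinFortWord (suc (suc (suc m))) = begin
  N (suc (suc (suc m))) w
    ≡⟨ countSubsets-suc (suc (suc m)) w ⟩
  N (suc (suc m)) (w ∘ 1∷_) + N (suc (suc m)) (w ∘ 0∷_)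
    ≡⟨ cong₂ _+_ (countSubsets-suc (suc m) (w ∘ 1∷_)) (none (suc (suc m))) ⟩
  N (suc m) (w ∘ 1∷_ ∘ 1∷_) + N (suc m) (w ∘ 1∷_ ∘ 0∷_) + 0
    ≡⟨ cong (_+ 0) (cong₂ _+_ (countSubsets-suc m (w ∘ 1∷_ ∘ 1∷_))
                              (countᵇ-cong isMinFortWord-10∷ (allSubsets (suc m)))) ⟩
  N m (w ∘ 1∷_ ∘ 1∷_ ∘ 1∷_) + N m (w ∘ 1∷_ ∘ 1∷_ ∘ 0∷_) + N (suc m) w + 0
    ≡⟨ cong (λ n → n + N (suc m) w + 0)
            (cong₂ _+_ (none m) (countᵇ-cong isMinFortWord-110∷ (allSubsets m))) ⟩
  N m w + N (suc m) w + 0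
    ≡⟨ cong₂ (λ x y → x + y + 0) (countSubsets-isMinFortWord m)
                                 (countSubsets-isMinFortWord (suc m)) ⟩
  padovan m + padovan (suc m) + 0
    ≡⟨ trans (+-identityʳ _) (+-comm (padovan m) _) ⟩
  padovan (suc m) + padovan m
    ∎
  where
  open ≡-Reasoning
  N = countSubsets
  w : ∀ {k} → Subset k → Bool
  w = isMinFortWord
  1∷_ 0∷_ : ∀ {k} → Subset k → Subset (suc k)
  1∷_ = inside ∷_
  0∷_ = outside ∷_
  none : ∀ k → N k (λ _ → false) ≡ 0
  none k = countᵇ-none (λ _ → refl) (allSubsets k)

FP≡padovan : (m : ℕ) → FP m ≡ padovan m
FP≡padovan m = begin
  FP m
    ≡⟨ cong length (filter-≐ _ (T? ∘ isMinFortWord) minFort≐minFortWord (allSubsets m)) ⟩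
  length (filter (T? ∘ isMinFortWord) (allSubsets m))
    ≡⟨ length-filter≡countᵇ (T? ∘ isMinFortWord) (allSubsets m) ⟩
  countSubsets m isMinFortWord
    ≡⟨ countSubsets-isMinFortWord m ⟩
  padovan m
    ∎
  where
  open ≡-Reasoning
  minFort≐minFortWord : IsMinimalFort ≐ (T ∘ isMinFortWord {m})
  minFort≐minFortWord = (λ {F} → to (IsMinimalFort⇔isMinFortWord F))
                      , (λ {F} → from (IsMinimalFort⇔isMinFortWord F))

-- The inequality

mono-≤-from-suc : (f : ℕ → ℕ) → (∀ n → f n ≤ f (suc n)) → ∀ {m n} → m ≤ n → f m ≤ f n
mono-≤-from-suc f f≤f∘suc m≤n = go (≤⇒≤′ m≤n)
  where
  go : ∀ {m n} → m ≤′ n → f m ≤ f n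
  go ≤′-refl        = ≤-refl
  go (≤′-step m≤′n) = ≤-trans (go m≤′n) (f≤f∘suc _)

[1+n]C2≡n+nC2 : (n : ℕ) → suc n C 2 ≡ n + n C 2
[1+n]C2≡n+nC2 n = trans (sym (nCk+nC[k+1]≡[n+1]C[k+1] n 1)) (cong (_+ n C 2) (nC1≡n n))

nC2-mono-≤ : ∀ {m n} → m ≤ n → m C 2 ≤ n C 2
nC2-mono-≤ = mono-≤-from-suc (_C 2) λ n →
  subst (n C 2 ≤_) (sym ([1+n]C2≡n+nC2 n)) (m≤n+m (n C 2) n)

padovan-≤-suc : (n : ℕ) → padovan n ≤ padovan (suc n)
padovan-≤-suc 0                   = z≤n
padovan-≤-suc 1                   = ≤-refl
padovan-≤-suc 2                   = ≤-refl
padovan-≤-suc (suc (suc (suc n))) = +-mono-≤ (padovan-≤-suc (suc n)) (padovan-≤-suc n)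

padovan-mono-≤ : ∀ {m n} → m ≤ n → padovan m ≤ padovan n
padovan-mono-≤ = mono-≤-from-suc padovan padovan-≤-suc

padovan-pos : (n : ℕ) → 1 ≤ padovan (suc n)
padovan-pos n = padovan-mono-≤ {1} {suc n} (s≤s z≤n)

padovan[5+n]≡padovan[4+n]+padovan[n] : (n : ℕ) → padovan (5 + n) ≡ padovan (4 + n) + padovan n
padovan[5+n]≡padovan[4+n]+padovan[n] n = lemma (padovan n) (padovan (1 + n)) (padovan (2 + n))
  where
  lemma : ∀ x y z → y + x + z ≡ z + y + x
  lemma = solve-∀

5*padovan[5+n]≤padovan[11+n] : (n : ℕ) → 5 * padovan (5 + n) ≤ padovan (11 + n)
5*padovan[5+n]≤padovan[11+n] n = +-cancelʳ-≤ (2 * y) _ _ (begin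
  5 * padovan (5 + n) + 2 * y  ≡⟨ unfold x y z ⟩
  padovan (11 + n) + x         ≤⟨ +-monoʳ-≤ (padovan (11 + n)) x≤2y ⟩
  padovan (11 + n) + 2 * y     ∎)
  where
  open ≤-Reasoning
  x = padovan n
  y = padovan (1 + n)
  z = padovan (2 + n)
  x≤2y : x ≤ 2 * y
  x≤2y = ≤-trans (padovan-≤-suc n) (m≤m+n y (y + 0))
  -- the right-hand side is padovan (11 + n) + x, unfolded by the recurrence down to x, y, z
  unfold : ∀ x y z → 5 * (y + x + z) + 2 * y ≡
    y + x + z + (z + y) + (z + y + (y + x)) + (z + y + (y + x) + (y + x + z)) + x
  unfold = solve-∀

padovan-binomial-bound-5 : (k : ℕ) →
  5 C 2 + 5 * (k C 2) * padovan k ≤ ((6 + k) C 2) * padovan (6 + k)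
padovan-binomial-bound-5 0 = ≤ᵇ⇒≤ _ _ tt
padovan-binomial-bound-5 1 = ≤ᵇ⇒≤ _ _ tt
padovan-binomial-bound-5 2 = ≤ᵇ⇒≤ _ _ tt
padovan-binomial-bound-5 3 = ≤ᵇ⇒≤ _ _ tt
padovan-binomial-bound-5 4 = ≤ᵇ⇒≤ _ _ tt
padovan-binomial-bound-5 (suc (suc (suc (suc (suc n))))) = begin
  10 + 5 * c * x        ≡⟨ regroup c x ⟩
  c * (5 * x) + 10 * 1  ≤⟨ +-mono-≤ (*-monoʳ-≤ c 5x≤a) (*-monoʳ-≤ 10 (padovan-pos (10 + n))) ⟩
  c * a + 10 * a        ≡⟨ collect c a ⟩
  (c + 10) * a          ≤⟨ *-monoˡ-≤ a c+10≤C ⟩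
  ((11 + n) C 2) * a    ∎
  where
  open ≤-Reasoning
  c = (5 + n) C 2
  x = padovan (5 + n)
  a = padovan (11 + n)
  5x≤a : 5 * x ≤ a
  5x≤a = 5*padovan[5+n]≤padovan[11+n] n
  c+10≤C : c + 10 ≤ (11 + n) C 2
  c+10≤C = begin
    c + 10                   ≡⟨ +-comm c 10 ⟩
    10 + c                   ≤⟨ +-mono-≤ (m≤m+n 10 n) (nC2-mono-≤ (+-monoˡ-≤ n (m≤n+m 5 5))) ⟩
    (10 + n) + (10 + n) C 2  ≡⟨ sym ([1+n]C2≡n+nC2 (10 + n)) ⟩
    (11 + n) C 2             ∎
  regroup : ∀ c x → 10 + 5 * c * x ≡ c * (5 * x) + 10 * 1
  regroup = solve-∀
  collect : ∀ c a → c * a + 10 * a ≡ (c + 10) * a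
  collect = solve-∀

padovan-binomial-bound-step : ∀ p k m → p ≤ 4 + m → k ≤ m →
  p C 2 + p * (k C 2) * padovan k ≤ ((4 + m) C 2) * padovan (4 + m) →
  suc p C 2 + suc p * (k C 2) * padovan k ≤ ((5 + m) C 2) * padovan (5 + m)
padovan-binomial-bound-step p k m p≤n k≤m ih = begin
  suc p C 2 + suc p * c * x                ≡⟨ cong (_+ suc p * c * x) ([1+n]C2≡n+nC2 p) ⟩
  p + p C 2 + suc p * c * x                ≡⟨ regroup p (p C 2) c x ⟩
  p + (p C 2 + p * c * x) + c * x          ≤⟨ +-mono-≤ (+-mono-≤ p≤n*[a+b] ih) cx≤[nC2]b ⟩
  n * (a + b) + (n C 2) * a + (n C 2) * b  ≡⟨ collect n (n C 2) a b ⟩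
  (n + n C 2) * (a + b)                    ≡⟨ sym (cong₂ _*_ ([1+n]C2≡n+nC2 n) recurrence) ⟩
  (suc n C 2) * padovan (suc n)            ∎
  where
  open ≤-Reasoning
  n = 4 + m
  a = padovan n
  b = padovan m
  c = k C 2
  x = padovan k
  recurrence : padovan (suc n) ≡ a + b
  recurrence = padovan[5+n]≡padovan[4+n]+padovan[n] m
  p≤n*[a+b] : p ≤ n * (a + b)
  p≤n*[a+b] = begin
    p            ≤⟨ p≤n ⟩
    n            ≡⟨ sym (*-identityʳ n) ⟩
    n * 1        ≤⟨ *-monoʳ-≤ n (subst (1 ≤_) recurrence (padovan-pos n)) ⟩
    n * (a + b)  ∎
  cx≤[nC2]b : c * x ≤ (n C 2) * b
  cx≤[nC2]b = *-mono-≤ (nC2-mono-≤ (≤-trans k≤m (m≤n+m m 4))) (padovan-mono-≤ k≤m)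
  regroup : ∀ p q c x → p + q + suc p * c * x ≡ p + (q + p * c * x) + c * x
  regroup = solve-∀
  collect : ∀ n C a b → n * (a + b) + C * a + C * b ≡ (n + C) * (a + b)
  collect = solve-∀

padovan-binomial-bound : ∀ j k →
  (5 + j) C 2 + (5 + j) * (k C 2) * padovan k ≤ ((6 + j + k) C 2) * padovan (6 + j + k)
padovan-binomial-bound zero    k = padovan-binomial-bound-5 k
padovan-binomial-bound (suc j) k =
  padovan-binomial-bound-step (5 + j) k (2 + j + k)
    (≤-trans (n≤1+n (5 + j)) (m≤m+n (6 + j) k)) (m≤n+m k (2 + j)) (padovan-binomial-bound j k)

lemma30 : (n d : ℕ) → 8 ≤ n → 6 ≤ d → d ≤ n →
    ((d ∸ 1) C 2) + (d ∸ 1) * ((n ∸ d) C 2) * FP (n ∸ d) ≤ (n C 2) * FP n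
lemma30 n d _ 6≤d d≤n
  with j , refl ← m≤n⇒∃[o]m+o≡n 6≤d
     | k , refl ← m≤n⇒∃[o]m+o≡n d≤n
  rewrite m+n∸m≡n (6 + j) k | FP≡padovan k | FP≡padovan (6 + j + k)
  = padovan-binomial-bound j k
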